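{- Let $G$ be a graph of pathwidth $p$ and let $P_n$ be the path on $n$ vertices. Then $\mathrm{sn}(P_n \boxtimes G) \le 5p + 2$.
   Context: All graphs are finite, simple and undirected. A vertex order $\sigma$ is a total order of the vertices; two edges $(u,v)$, $(x,y)$ cross with respect to $\sigma$ if $u <_\sigma x <_\sigma v <_\sigma y$. A $k$-stack layout is a vertex order with a partition of the edges into $k$ sets of pairwise non-crossing edges; the stack number $\mathrm{sn}$ is the minimum such $k$. The strong product $A\boxtimes B$ has vertex set $V(A)\times V(B)$, with $(v,x)$ and $(u,y)$ adjacent iff either ($v=u$ and $(x,y)\in E(B)$), or ($x=y$ and $(v,u)\in E(A)$), or ($(v,u)\in E(A)$ and $(x,y)\in E(B)$). Pathwidth is the minimum width (maximum bag size minus one) of a path decomposition. -}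

module Defs where

open import Data.Nat using (ℕ; zero; suc; _+_; _*_; _≤_; _<_)
open import Data.Fin using (Fin; toℕ; remQuot)
open import Data.Fin.Subset using (Subset; _∈_; ∣_∣)
open import Data.Fin.Permutation using (Permutation′; _⟨$⟩ʳ_)
open import Data.Product using (Σ; ∃; _×_; _,_; proj₁; proj₂)
open import Data.Sum using (_⊎_)
open import Relation.Binary.PropositionalEquality using (_≡_; _≢_)
open import Relation.Nullary using (¬_)

record Graph : Set₁ where
  field
    n     : ℕ
    E     : Fin n → Fin n → Set
    sym   : ∀ {u v} → E u v → E v u
    irrefl : ∀ {u} → ¬ E u u
open Graph public

Path : ℕ → Graph
Path k = record
  { n = k
  ; E = λ i j → suc (toℕ i) ≡ toℕ j ⊎ suc (toℕ j) ≡ toℕ i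
  ; sym = λ { (Data.Sum.inj₁ e) → Data.Sum.inj₂ e ; (Data.Sum.inj₂ e) → Data.Sum.inj₁ e }
  ; irrefl = λ { (Data.Sum.inj₁ e) → nosuc e ; (Data.Sum.inj₂ e) → nosuc e }
  }
  where
  nosuc : ∀ {m} → suc m ≢ m
  nosuc {zero} ()
  nosuc {suc m} refl' = nosuc {m} (Data.Nat.Properties.suc-injective refl')
    where import Data.Nat.Properties

-- Strong product A ⊠ B; vertex (a , b) is encoded as an element of
-- Fin (n A * n B) via the standard bijection remQuot / combine.
_⊠_ : Graph → Graph → Graph
A ⊠ B = record
  { n = n A * n B
  ; E = λ p q → SE (remQuot (n B) p) (remQuot (n B) q)
  ; sym = λ { (Data.Sum.inj₁ (e , f)) → Data.Sum.inj₁ (Relation.Binary.PropositionalEquality.sym e , Graph.sym B f)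
            ; (Data.Sum.inj₂ (Data.Sum.inj₁ (e , f))) → Data.Sum.inj₂ (Data.Sum.inj₁ (Relation.Binary.PropositionalEquality.sym e , Graph.sym A f))
            ; (Data.Sum.inj₂ (Data.Sum.inj₂ (e , f))) → Data.Sum.inj₂ (Data.Sum.inj₂ (Graph.sym A e , Graph.sym B f)) }
  ; irrefl = λ { (Data.Sum.inj₁ (_ , f)) → Graph.irrefl B f
               ; (Data.Sum.inj₂ (Data.Sum.inj₁ (_ , f))) → Graph.irrefl A f
               ; (Data.Sum.inj₂ (Data.Sum.inj₂ (e , _))) → Graph.irrefl A e }
  }
  where
  SE : Fin (n A) × Fin (n B) → Fin (n A) × Fin (n B) → Set
  SE (v , x) (u , y) = (v ≡ u × E B x y) ⊎ ((x ≡ y × E A v u) ⊎ (E A v u × E B x y))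

Crossing : ∀ {m} → Permutation′ m → Fin m → Fin m → Fin m → Fin m → Set
Crossing σ u v x y =
  toℕ (σ ⟨$⟩ʳ u) < toℕ (σ ⟨$⟩ʳ x) ×
  (toℕ (σ ⟨$⟩ʳ x) < toℕ (σ ⟨$⟩ʳ v) × toℕ (σ ⟨$⟩ʳ v) < toℕ (σ ⟨$⟩ʳ y))

record StackLayout (G : Graph) (k : ℕ) : Set where
  field
    σ      : Permutation′ (n G)
    stack  : ∀ {u v} → E G u v → Fin k
    stack-sym : ∀ {u v} (e : E G u v) → stack (Graph.sym G e) ≡ stack e
    noCross : ∀ {u v x y} (e : E G u v) (f : E G x y) →
              Crossing σ u v x y → stack e ≢ stack f

sn≤ : Graph → ℕ → Set
sn≤ G k = StackLayout G k

record PathDecomposition (G : Graph) : Set where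
  field
    len   : ℕ
    bag   : Fin len → Subset (n G)
    vcover : ∀ v → ∃ λ i → v ∈ bag i
    ecover : ∀ {u v} → E G u v → ∃ λ i → (u ∈ bag i × v ∈ bag i)
    contiguous : ∀ v (i j l : Fin len) → toℕ i ≤ toℕ j → toℕ j ≤ toℕ l →
                 v ∈ bag i → v ∈ bag l → v ∈ bag j
open PathDecomposition public

WidthAtMost : ∀ {G} → PathDecomposition G → ℕ → Set
WidthAtMost D w = ∀ i → ∣ bag D i ∣ ≤ suc w

Pathwidth : Graph → ℕ → Set
Pathwidth G p =
  (Σ (PathDecomposition G) λ D → WidthAtMost D p) ×
  (∀ w → w < p → ¬ (Σ (PathDecomposition G) λ D → WidthAtMost D w))

-- Fix a path decomposition of G of width p and order V(G) by the first bag containing each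
-- vertex. Colour V(G) greedily in this order with p + 1 colours so that every vertex differs
-- from the earlier vertices of its first bag; then an edge uw with u < v ≤ w forces
-- colour u ≠ colour v, because u lies in the first bag of v.
-- Lay out P_k ⊠ G block by block (block i is {i} × V(G)), traversing even blocks forwards and
-- odd blocks backwards. An edge gets a stack determined by the parity of its lower block,
-- whether it ascends or descends in the order of V(G), and the colour of one endpoint; two
-- crossing edges with the same data would make an edge jump over a vertex of its own colour.
-- This needs 4(p + 1) ≤ 5p + 2 stacks when p ≥ 2; when p ≤ 1 the descending edges of a given
-- parity share one stack, since a crossing pair of them would need three distinct colours.

module Submission where

open import Data.Bool.Base using (Bool; true; false)
open import Data.Bool.Properties using (T-≡)
open import Data.Empty using (⊥)
open import Data.Fin.Base using (Fin; toℕ; fromℕ<; punchOut; remQuot; combine)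
  renaming (zero to fzero; suc to fsuc)
open import Data.Fin.Permutation using (Permutation′; _⟨$⟩ʳ_)
open import Data.Fin.Properties
  using (any?; combine-remQuot; fromℕ<-cong; fromℕ<-injective; injective⇒≤; punchOut-injective;
         toℕ<n; toℕ-fromℕ<; toℕ-injective)
  renaming (_≟_ to _≟ᶠ_; suc-injective to fsuc-injective)
open import Data.Fin.Subset using (Subset; _∈_; _∉_; _⊂_; ∣_∣; ⊤)
open import Data.Fin.Subset.Properties using (_∈?_; p⊂q⇒∣p∣<∣q∣; ∣⊤∣≡n; ∈⊤)
open import Data.Nat.Base using (ℕ; zero; suc; _+_; _*_; _∸_; _≤_; _<_; z≤n; s≤s; _<ᵇ_; parity)
open import Data.Nat.Properties
open import Data.Nat.Tactic.RingSolver using (solve-∀)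
open import Data.Parity.Base using (Parity; 0ℙ; 1ℙ; _⁻¹)
open import Data.Parity.Properties using (p≢p⁻¹)
open import Data.Product using (Σ; ∃; _×_; _,_; proj₁; proj₂; uncurry)
open import Data.Sum.Base using (_⊎_; inj₁; inj₂)
open import Data.Vec.Base using (tabulate; _∷_; here; there)
open import Data.Vec.Properties using (lookup∘tabulate; []=⇒lookup; lookup⇒[]=)
open import Function.Base using (_∘_)
open import Function.Bundles using (mk↔ₛ′; Equivalence)
open import Function.Definitions using (Injective)
open import Relation.Binary.Construct.Closure.Reflexive using (ReflClosure; refl; [_])
open import Relation.Binary.Definitions using (tri<; tri≈; tri>)
open import Relation.Binary.PropositionalEquality as ≡
  using (_≡_; _≢_; refl; cong; cong₂; subst; subst₂; ≢-sym)
open import Relation.Nullary using (Dec; yes; no; contradiction; ¬?; _×-dec_)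
open import Relation.Nullary.Decidable using (decidable-stable)
open import Relation.Unary using (Pred; Decidable)

open import Defs

lex-< : ∀ {n a b x y} → a < b → x < n → a * n + x < b * n + y
lex-< {n} {a} {b} {x} {y} a<b x<n = begin-strict
  a * n + x  <⟨ +-monoʳ-< (a * n) x<n ⟩
  a * n + n  ≡⟨ +-comm (a * n) n ⟩
  suc a * n  ≤⟨ *-monoˡ-≤ n a<b ⟩
  b * n      ≤⟨ m≤m+n (b * n) y ⟩
  b * n + y  ∎
  where open ≤-Reasoning

lex-≤⇒≤ : ∀ {n a b x y} → y < n → a * n + x ≤ b * n + y → a ≤ b
lex-≤⇒≤ y<n le = ≮⇒≥ λ b<a → <⇒≱ (lex-< b<a y<n) le

lex-injective : ∀ {n a b x y} → x < n → y < n → a * n + x ≡ b * n + y → a ≡ b × x ≡ y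
lex-injective {n} {a} {b} {x} {y} x<n y<n e =
  a≡b , +-cancelˡ-≡ (a * n) x y (≡.trans e (cong (λ c → c * n + y) (≡.sym a≡b)))
  where
  a≡b : a ≡ b
  a≡b = ≤-antisym (lex-≤⇒≤ y<n (≤-reflexive e)) (lex-≤⇒≤ x<n (≤-reflexive (≡.sym e)))

minimal : ∀ {m ℓ} {P : Pred (Fin m) ℓ} → Decidable P → ∃ P →
          Σ (Fin m) λ i → P i × (∀ j → P j → toℕ i ≤ toℕ j)
minimal {suc m} P? ex with P? fzero
... | yes P0 = fzero , P0 , λ _ _ → z≤n
minimal {suc m} P? (fzero , P0) | no ¬P0 = contradiction P0 ¬P0
minimal {suc m} P? (fsuc j , Pj) | no ¬P0 with minimal (P? ∘ fsuc) (j , Pj)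
... | i , Pi , least = fsuc i , Pi , λ where
  fzero  P0 → contradiction P0 ¬P0
  (fsuc k) Pk → s≤s (least k Pk)

injective⇒surjective : ∀ {m} (f : Fin m → Fin m) → Injective _≡_ _≡_ f →
                       ∀ y → ∃ λ x → f x ≡ y
injective⇒surjective {suc m} f f-inj y with any? (λ x → f x ≟ᶠ y)
... | yes hit = hit
... | no miss = contradiction (injective⇒≤ g-inj) (<-irrefl refl)
  where
  f≢y : ∀ x → y ≢ f x
  f≢y x y≡fx = miss (x , ≡.sym y≡fx)
  g : Fin (suc m) → Fin m
  g x = punchOut (f≢y x)
  g-inj : Injective _≡_ _≡_ g
  g-inj e = f-inj (punchOut-injective (f≢y _) (f≢y _) e)

injective⇒permutation : ∀ {m} (f : Fin m → Fin m) → Injective _≡_ _≡_ f → Permutation′ m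
injective⇒permutation f f-inj =
  mk↔ₛ′ f preimage (λ y → proj₂ (surj y)) (λ x → f-inj (proj₂ (surj (f x))))
  where
  surj : ∀ y → ∃ λ x → f x ≡ y
  surj = injective⇒surjective f f-inj
  preimage : Fin _ → Fin _
  preimage y = proj₁ (surj y)

∈-tabulate⁺ : ∀ {m} {f : Fin m → Bool} {x} → f x ≡ true → x ∈ tabulate f
∈-tabulate⁺ {f = f} {x} fx = lookup⇒[]= x _ (≡.trans (lookup∘tabulate f x) fx)

∈-tabulate⁻ : ∀ {m} {f : Fin m → Bool} {x} → x ∈ tabulate f → f x ≡ true
∈-tabulate⁻ {f = f} {x} x∈ = ≡.trans (≡.sym (lookup∘tabulate f x)) ([]=⇒lookup x∈)

module Ranking {m : ℕ} (K : Fin m → ℕ) (K-injective : Injective _≡_ _≡_ K) where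

  below : Fin m → Subset m
  below x = tabulate (λ y → K y <ᵇ K x)

  ∈below⁺ : ∀ {x y} → K y < K x → y ∈ below x
  ∈below⁺ lt = ∈-tabulate⁺ (Equivalence.to T-≡ (<⇒<ᵇ lt))

  ∈below⁻ : ∀ {x y} → y ∈ below x → K y < K x
  ∈below⁻ {x} {y} y∈ = <ᵇ⇒< (K y) (K x) (Equivalence.from T-≡ (∈-tabulate⁻ y∈))

  x∉below : ∀ x → x ∉ below x
  x∉below x x∈ = <-irrefl refl (∈below⁻ x∈)

  below⊂below : ∀ {x y} → K x < K y → below x ⊂ below y
  below⊂below lt = (λ z∈ → ∈below⁺ (<-trans (∈below⁻ z∈) lt)) , _ , ∈below⁺ lt , x∉below _

  ∣below∣<m : ∀ x → ∣ below x ∣ < m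
  ∣below∣<m x =
    subst (∣ below x ∣ <_) (∣⊤∣≡n m) (p⊂q⇒∣p∣<∣q∣ ((λ _ → ∈⊤) , x , ∈⊤ , x∉below x))

  rank : Fin m → Fin m
  rank x = fromℕ< (∣below∣<m x)

  rank-<⇒ : ∀ {x y} → K x < K y → toℕ (rank x) < toℕ (rank y)
  rank-<⇒ lt =
    subst₂ _<_ (≡.sym (toℕ-fromℕ< _)) (≡.sym (toℕ-fromℕ< _)) (p⊂q⇒∣p∣<∣q∣ (below⊂below lt))

  rank-injective : Injective _≡_ _≡_ rank
  rank-injective {x} {y} e with <-cmp (K x) (K y)
  ... | tri< lt _ _ = contradiction (cong toℕ e) (<⇒≢ (rank-<⇒ lt))
  ... | tri≈ _ eq _ = K-injective eq
  ... | tri> _ _ gt = contradiction (cong toℕ e) (≢-sym (<⇒≢ (rank-<⇒ gt)))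

  σ : Permutation′ m
  σ = injective⇒permutation rank rank-injective

  σ-reflects-< : ∀ {x y} → toℕ (σ ⟨$⟩ʳ x) < toℕ (σ ⟨$⟩ʳ y) → K x < K y
  σ-reflects-< {x} {y} lt with <-cmp (K x) (K y)
  ... | tri< Kx<Ky _ _ = Kx<Ky
  ... | tri≈ _ Kx≡Ky _ = contradiction (cong (toℕ ∘ rank) (K-injective Kx≡Ky)) (<⇒≢ lt)
  ... | tri> _ _ Ky<Kx = contradiction (rank-<⇒ Ky<Kx) (<-asym lt)

index : ∀ {m} (B : Subset m) {x} → x ∈ B → Fin ∣ B ∣
index (true ∷ B)  here       = fzero
index (true ∷ B)  (there x∈) = fsuc (index B x∈)
index (false ∷ B) (there x∈) = index B x∈

index-injective : ∀ {m} (B : Subset m) {x y} (x∈ : x ∈ B) (y∈ : y ∈ B) →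
                  index B x∈ ≡ index B y∈ → x ≡ y
index-injective (true ∷ B)  here       here       _ = refl
index-injective (true ∷ B)  (there x∈) (there y∈) e =
  cong fsuc (index-injective B x∈ y∈ (fsuc-injective e))
index-injective (false ∷ B) (there x∈) (there y∈) e = cong fsuc (index-injective B x∈ y∈ e)

injective-into-subset⇒≤ : ∀ {k m} (B : Subset m) (f : Fin k → Fin m) → Injective _≡_ _≡_ f →
                          (∀ i → f i ∈ B) → k ≤ ∣ B ∣
injective-into-subset⇒≤ B f f-inj f∈B =
  injective⇒≤ {f = λ i → index B (f∈B i)} (λ e → f-inj (index-injective B (f∈B _) (f∈B _) e))

no-three-distinct : ∀ {p} → p ≤ 1 → (a b c : Fin (suc p)) → a ≢ b → b ≢ c → a ≢ c → ⊥
no-three-distinct _ fzero        fzero        _            a≢b _   _   = a≢b refl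
no-three-distinct _ fzero        (fsuc fzero) fzero        _   _   a≢c = a≢c refl
no-three-distinct _ fzero        (fsuc fzero) (fsuc fzero) _   b≢c _   = b≢c refl
no-three-distinct _ (fsuc fzero) fzero        fzero        _   b≢c _   = b≢c refl
no-three-distinct _ (fsuc fzero) fzero        (fsuc fzero) _   _   a≢c = a≢c refl
no-three-distinct _ (fsuc fzero) (fsuc fzero) _            a≢b _   _   = a≢b refl
no-three-distinct {suc (suc _)} (s≤s ()) _ _ _ _ _ _

distinct⇒1≤ : ∀ {p} (a b : Fin (suc p)) → a ≢ b → 1 ≤ p
distinct⇒1≤ {zero}  fzero fzero a≢b = contradiction refl a≢b
distinct⇒1≤ {suc p} _     _     _   = s≤s z≤n

module FirstBagOrder (G : Graph) (D : PathDecomposition G) where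

  _⋆_ : Fin (n G) → Fin (n G) → Set
  _⋆_ = ReflClosure (E G)

  ⋆-sym : ∀ {u v} → u ⋆ v → v ⋆ u
  ⋆-sym refl  = refl
  ⋆-sym [ e ] = [ Graph.sym G e ]

  private
    firstBag : ∀ v → Σ (Fin (len D)) λ i → v ∈ bag D i × (∀ j → v ∈ bag D j → toℕ i ≤ toℕ j)
    firstBag v = minimal (λ i → v ∈? bag D i) (vcover D v)

  first : Fin (n G) → Fin (len D)
  first v = proj₁ (firstBag v)

  ∈-first : ∀ v → v ∈ bag D (first v)
  ∈-first v = proj₁ (proj₂ (firstBag v))

  first-minimal : ∀ v j → v ∈ bag D j → toℕ (first v) ≤ toℕ j
  first-minimal v = proj₂ (proj₂ (firstBag v))

  key : Fin (n G) → ℕ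
  key v = toℕ (first v) * n G + toℕ v

  key< : ∀ v → key v < len D * n G
  key< v = ≤-trans (lex-< (toℕ<n (first v)) (toℕ<n v)) (≤-reflexive (+-identityʳ (len D * n G)))

  key-injective : Injective _≡_ _≡_ key
  key-injective {u} {v} e =
    toℕ-injective (proj₂ (lex-injective {a = toℕ (first u)} {b = toℕ (first v)} (toℕ<n u) (toℕ<n v) e))

  key-≤⇒first-≤ : ∀ {u v} → key u ≤ key v → toℕ (first u) ≤ toℕ (first v)
  key-≤⇒first-≤ {v = v} = lex-≤⇒≤ (toℕ<n v)

  ∈-first-of-neighbour : ∀ {u w} → u ⋆ w → key u ≤ key w → u ∈ bag D (first w)
  ∈-first-of-neighbour {u} refl  _ = ∈-first u
  ∈-first-of-neighbour {u} {w} [ e ] u≤w with ecover D e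
  ... | j , u∈j , w∈j =
    contiguous D u (first u) (first w) j (key-≤⇒first-≤ u≤w) (first-minimal w j w∈j) (∈-first u) u∈j

  ∈-first-between : ∀ {u v w} → u ⋆ w → key u ≤ key v → key v ≤ key w → u ∈ bag D (first v)
  ∈-first-between {u} {v} {w} u⋆w u≤v v≤w =
    contiguous D u (first u) (first v) (first w) (key-≤⇒first-≤ u≤v) (key-≤⇒first-≤ v≤w)
      (∈-first u) (∈-first-of-neighbour u⋆w (≤-trans u≤v v≤w))

module GreedyColouring (G : Graph) (p : ℕ) (D : PathDecomposition G) (width : WidthAtMost D p) where

  open FirstBagOrder G D public

  Colouring : Set
  Colouring = Fin (n G) → Fin (suc p)

  ProperBelow : ℕ → Colouring → Set
  ProperBelow t c = ∀ {u v} → key u < key v → key v < t → u ∈ bag D (first v) → c u ≢ c v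

  module _ (c : Colouring) (v : Fin (n G)) where

    private
      Used : Fin (suc p) → Set
      Used c₀ = ∃ λ u → u ∈ bag D (first v) × key u < key v × c u ≡ c₀

      used? : Decidable Used
      used? c₀ = any? λ u → (u ∈? bag D (first v)) ×-dec (key u <? key v) ×-dec (c u ≟ᶠ c₀)

      all-used⇒wide : (∀ c₀ → Used c₀) → suc (suc p) ≤ ∣ bag D (first v) ∣
      all-used⇒wide used = injective-into-subset⇒≤ (bag D (first v)) witness witness-injective witness∈
        where
        witness : Fin (suc (suc p)) → Fin (n G)
        witness fzero     = v
        witness (fsuc c₀) = proj₁ (used c₀)

        witness∈ : ∀ i → witness i ∈ bag D (first v)
        witness∈ fzero     = ∈-first v
        witness∈ (fsuc c₀) = proj₁ (proj₂ (used c₀))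

        witness≢v : ∀ c₀ → proj₁ (used c₀) ≢ v
        witness≢v c₀ e = <-irrefl (cong key e) (proj₁ (proj₂ (proj₂ (used c₀))))

        witness-injective : Injective _≡_ _≡_ witness
        witness-injective {fzero}  {fzero}  _ = refl
        witness-injective {fzero}  {fsuc j} e = contradiction (≡.sym e) (witness≢v j)
        witness-injective {fsuc i} {fzero}  e = contradiction e (witness≢v i)
        witness-injective {fsuc i} {fsuc j} e =
          cong fsuc (≡.trans (≡.sym (colour-of i)) (≡.trans (cong c e) (colour-of j)))
          where
          colour-of : ∀ c₀ → c (proj₁ (used c₀)) ≡ c₀
          colour-of c₀ = proj₂ (proj₂ (proj₂ (used c₀)))

    free-colour : ∃ λ c₀ → ∀ {u} → u ∈ bag D (first v) → key u < key v → c u ≢ c₀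
    free-colour with any? (λ c₀ → ¬? (used? c₀))
    ... | yes (c₀ , unused) = c₀ , λ u∈ u<v cu≡c₀ → unused (_ , u∈ , u<v , cu≡c₀)
    ... | no none = contradiction (≤-trans (all-used⇒wide used) (width (first v))) (<-irrefl refl)
      where
      used : ∀ c₀ → Used c₀
      used c₀ = decidable-stable (used? c₀) (λ unused → none (c₀ , unused))

  recolour : Colouring → Fin (n G) → Fin (suc p) → Colouring
  recolour c v c₀ x with x ≟ᶠ v
  ... | yes _ = c₀
  ... | no _  = c x

  recolour-at : ∀ c v c₀ → recolour c v c₀ v ≡ c₀
  recolour-at c v c₀ with v ≟ᶠ v
  ... | yes _ = refl
  ... | no v≢v = contradiction refl v≢v

  recolour-elsewhere : ∀ c v c₀ {x} → x ≢ v → recolour c v c₀ x ≡ c x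
  recolour-elsewhere c v c₀ {x} x≢v with x ≟ᶠ v
  ... | yes x≡v = contradiction x≡v x≢v
  ... | no _    = refl

  recolour-proper : ∀ {t c v} → ProperBelow t c → key v ≡ t →
                    ProperBelow (suc t) (recolour c v (proj₁ (free-colour c v)))
  recolour-proper {t} {c} {v} proper kv≡t {u} {w} u<w w≤t u∈ = by-cases (w ≟ᶠ v)
    where
    c₀ : Fin (suc p)
    c₀ = proj₁ (free-colour c v)
    c′ : Colouring
    c′ = recolour c v c₀

    by-cases : Dec (w ≡ v) → c′ u ≢ c′ w
    by-cases (yes w≡v) e =
      proj₂ (free-colour c v) (subst (λ z → u ∈ bag D (first z)) w≡v u∈) (subst (λ z → key u < key z) w≡v u<w)
        (≡.trans (≡.sym (recolour-elsewhere c v c₀ u≢v))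
          (≡.trans e (≡.trans (cong c′ w≡v) (recolour-at c v c₀))))
      where
      u≢v : u ≢ v
      u≢v u≡v = <-irrefl (cong key (≡.trans u≡v (≡.sym w≡v))) u<w
    by-cases (no w≢v) e =
      proper u<w w<t u∈
        (≡.trans (≡.sym (recolour-elsewhere c v c₀ u≢v)) (≡.trans e (recolour-elsewhere c v c₀ w≢v)))
      where
      w<t : key w < t
      w<t = ≤∧≢⇒< (≤-pred w≤t) (λ kw≡t → w≢v (key-injective (≡.trans kw≡t (≡.sym kv≡t))))
      u≢v : u ≢ v
      u≢v u≡v = <-irrefl (≡.trans (cong key u≡v) kv≡t) (<-≤-trans u<w (≤-pred w≤t))

  proper-below : ∀ t → ∃ (ProperBelow t)
  proper-below zero = (λ _ → fzero) , λ _ ()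
  proper-below (suc t) with proper-below t | any? (λ v → key v ≟ t)
  ... | c , proper | yes (v , kv≡t) = _ , recolour-proper proper kv≡t
  ... | c , proper | no none =
    c , λ u<w w≤t → proper u<w (≤∧≢⇒< (≤-pred w≤t) (λ e → none (_ , e)))

  colour : Colouring
  colour = proj₁ (proper-below (len D * n G))

  colour-proper : ∀ {u v} → key u < key v → u ∈ bag D (first v) → colour u ≢ colour v
  colour-proper {v = v} u<v = proj₂ (proper-below (len D * n G)) u<v (key< v)

  colour-separated : ∀ {u v w} → u ⋆ w → key u < key v → key v ≤ key w → colour u ≢ colour v
  colour-separated u⋆w u<v v≤w = colour-proper u<v (∈-first-between u⋆w (<⇒≤ u<v) v≤w)

  lowerColour : Fin (n G) → Fin (n G) → Fin (suc p)
  lowerColour u v with key u ≤? key v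
  ... | yes _ = colour u
  ... | no _  = colour v

  lowerColour-≤ : ∀ {u v} → key u ≤ key v → lowerColour u v ≡ colour u
  lowerColour-≤ {u} {v} u≤v with key u ≤? key v
  ... | yes _   = refl
  ... | no u≰v = contradiction u≤v u≰v

  lowerColour-> : ∀ {u v} → key v < key u → lowerColour u v ≡ colour v
  lowerColour-> {u} {v} v<u with key u ≤? key v
  ... | yes u≤v = contradiction u≤v (<⇒≱ v<u)
  ... | no _    = refl

  lowerColour-sym : ∀ u v → lowerColour u v ≡ lowerColour v u
  lowerColour-sym u v with <-cmp (key u) (key v)
  ... | tri< u<v _ _ = ≡.trans (lowerColour-≤ (<⇒≤ u<v)) (≡.sym (lowerColour-> u<v))
  ... | tri≈ _ u≡v _ = cong₂ lowerColour (key-injective u≡v) (≡.sym (key-injective u≡v))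
  ... | tri> _ _ v<u = ≡.trans (lowerColour-> v<u) (≡.sym (lowerColour-≤ (<⇒≤ v<u)))

  -- The order in which the snake layout visits a block of parity π. The 1ℙ order is the reverse
  -- of the 0ℙ order, so each 1ℙ case below is a 0ℙ case with the roles of the endpoints exchanged.
  Before : Parity → Fin (n G) → Fin (n G) → Set
  Before 0ℙ u v = key u < key v
  Before 1ℙ u v = key v < key u

  lowerColour-between : ∀ π {u v x} → E G u v → Before π u x → Before π x v →
                        lowerColour u v ≢ colour x
  lowerColour-between 0ℙ e u<x x<v eq =
    colour-separated [ e ] u<x (<⇒≤ x<v) (≡.trans (≡.sym (lowerColour-≤ (<⇒≤ (<-trans u<x x<v)))) eq)
  lowerColour-between 1ℙ {u} {v} e x<u v<x eq =
    lowerColour-between 0ℙ (Graph.sym G e) v<x x<u (≡.trans (lowerColour-sym v u) eq)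

  within-crossing : ∀ π {u v x y} → E G u v → E G x y → Before π u x → Before π x v → Before π v y →
                    lowerColour u v ≢ lowerColour x y
  within-crossing 0ℙ e _ u<x x<v v<y eq =
    lowerColour-between 0ℙ e u<x x<v (≡.trans eq (lowerColour-≤ (<⇒≤ (<-trans x<v v<y))))
  within-crossing 1ℙ {u} {v} {x} {y} e f x<u v<x y<v eq =
    within-crossing 0ℙ (Graph.sym G f) (Graph.sym G e) y<v v<x x<u
      (≡.trans (lowerColour-sym y x) (≡.trans (≡.sym eq) (lowerColour-sym u v)))

  rising-crossing : ∀ π {u v x y} → u ⋆ v → x ⋆ y → key u ≤ key v → key x ≤ key y →
                    Before π u x → Before (π ⁻¹) v y → colour u ≢ colour x
  rising-crossing 0ℙ u⋆v _   _   x≤y u<x y<v = colour-separated u⋆v u<x (≤-trans x≤y (<⇒≤ y<v))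
  rising-crossing 1ℙ u⋆v x⋆y u≤v x≤y x<u v<y = ≢-sym (rising-crossing 0ℙ x⋆y u⋆v x≤y u≤v x<u v<y)

  falling-crossing : ∀ π {u v x y} → u ⋆ v → x ⋆ y → key v < key u → key y < key x →
                     Before π u x → Before (π ⁻¹) v y → colour v ≢ colour y
  falling-crossing 0ℙ _   x⋆y v<u _   u<x y<v =
    ≢-sym (colour-separated (⋆-sym x⋆y) y<v (<⇒≤ (<-trans v<u u<x)))
  falling-crossing 1ℙ u⋆v x⋆y v<u y<x x<u v<y = ≢-sym (falling-crossing 0ℙ x⋆y u⋆v y<x v<u x<u v<y)

  falling-crossing-narrow : p ≤ 1 → ∀ π {u v x y} → u ⋆ v → x ⋆ y → key v < key u → key y < key x →
                            Before π u x → Before (π ⁻¹) v y → ⊥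
  falling-crossing-narrow p≤1 0ℙ {u} {v} {x} {y} u⋆v x⋆y v<u y<x u<x y<v =
    no-three-distinct p≤1 (colour y) (colour v) (colour u)
      (≢-sym (falling-crossing 0ℙ u⋆v x⋆y v<u y<x u<x y<v))
      (colour-separated (⋆-sym u⋆v) v<u ≤-refl)
      (colour-separated (⋆-sym x⋆y) (<-trans y<v v<u) (<⇒≤ u<x))
  falling-crossing-narrow p≤1 1ℙ u⋆v x⋆y v<u y<x x<u v<y =
    falling-crossing-narrow p≤1 0ℙ x⋆y u⋆v y<x v<u x<u v<y

  falling⇒1≤p : ∀ {u v} → u ⋆ v → key v < key u → 1 ≤ p
  falling⇒1≤p {u} {v} u⋆v v<u =
    distinct⇒1≤ (colour v) (colour u) (colour-separated (⋆-sym u⋆v) v<u ≤-refl)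

parity-suc : ∀ i → parity (suc i) ≡ parity i ⁻¹
parity-suc zero          = refl
parity-suc (suc zero)    = refl
parity-suc (suc (suc i)) = parity-suc i

same-parity⇒≡ : ∀ {i j} → i ≤ j → j ≤ suc i → parity i ≡ parity j → j ≡ i
same-parity⇒≡ {i} i≤j j≤1+i same with m≤n⇒m<n∨m≡n j≤1+i
... | inj₁ j<1+i = ≤-antisym (m<1+n⇒m≤n j<1+i) i≤j
... | inj₂ refl  = contradiction (≡.trans same (parity-suc i)) (p≢p⁻¹ (parity i))

data Slope : Set where
  ascending descending : Slope

data StackLabel : Set where
  ⟨_,_,_⟩ : Parity → Slope → ℕ → StackLabel

⟨⟩-injective : ∀ {π π′ s s′ c c′} → ⟨ π , s , c ⟩ ≡ ⟨ π′ , s′ , c′ ⟩ →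
               π ≡ π′ × s ≡ s′ × c ≡ c′
⟨⟩-injective refl = refl , refl , refl

lowBits : Parity → Slope → ℕ
lowBits 0ℙ ascending  = 0
lowBits 1ℙ ascending  = 1
lowBits 0ℙ descending = 2
lowBits 1ℙ descending = 3

lowBits⁻¹ : ℕ → Parity × Slope
lowBits⁻¹ 0 = 0ℙ , ascending
lowBits⁻¹ 1 = 1ℙ , ascending
lowBits⁻¹ 2 = 0ℙ , descending
lowBits⁻¹ _ = 1ℙ , descending

lowBits⁻¹-lowBits : ∀ π s → lowBits⁻¹ (lowBits π s) ≡ (π , s)
lowBits⁻¹-lowBits 0ℙ ascending  = refl
lowBits⁻¹-lowBits 1ℙ ascending  = refl
lowBits⁻¹-lowBits 0ℙ descending = refl
lowBits⁻¹-lowBits 1ℙ descending = refl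

lowBits≤3 : ∀ π s → lowBits π s ≤ 3
lowBits≤3 0ℙ ascending  = z≤n
lowBits≤3 1ℙ ascending  = s≤s z≤n
lowBits≤3 0ℙ descending = s≤s (s≤s z≤n)
lowBits≤3 1ℙ descending = ≤-refl

lowBits-ascending≤1 : ∀ π → lowBits π ascending ≤ 1
lowBits-ascending≤1 0ℙ = z≤n
lowBits-ascending≤1 1ℙ = ≤-refl

labels-agree : ∀ {ℓ π π′ s s′ c c′} → ℓ ≡ ⟨ π , s , c ⟩ → ℓ ≡ ⟨ π′ , s′ , c′ ⟩ →
               π ≡ π′ × s ≡ s′ × c ≡ c′
labels-agree refl e = ⟨⟩-injective e

encode : StackLabel → ℕ
encode ⟨ π , s , c ⟩ = c * 4 + lowBits π s

encode-injective : Injective _≡_ _≡_ encode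
encode-injective {⟨ π , s , c ⟩} {⟨ π′ , s′ , c′ ⟩} e
  with refl , low≡ ← lex-injective {a = c} {b = c′} (s≤s (lowBits≤3 π s)) (s≤s (lowBits≤3 π′ s′)) e
  with refl ← ≡.trans (≡.sym (lowBits⁻¹-lowBits π s)) (≡.trans (cong lowBits⁻¹ low≡) (lowBits⁻¹-lowBits π′ s′))
  = refl

encode-ascending< : ∀ {p c} π → c ≤ p → encode ⟨ π , ascending , c ⟩ < 5 * p + 2
encode-ascending< {p} {c} π c≤p = begin-strict
  c * 4 + lowBits π ascending  ≤⟨ +-mono-≤ (*-monoˡ-≤ 4 c≤p) (lowBits-ascending≤1 π) ⟩
  p * 4 + 1                    <⟨ ≤-trans (n<1+n _) (m≤m+n _ p) ⟩
  suc (p * 4 + 1) + p          ≡⟨ identity p ⟩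
  5 * p + 2                    ∎
  where
  open ≤-Reasoning
  identity : ∀ p → suc (p * 4 + 1) + p ≡ 5 * p + 2
  identity = solve-∀

encode-descending< : ∀ {p c} π → 2 ≤ p → c ≤ p → encode ⟨ π , descending , c ⟩ < 5 * p + 2
encode-descending< {suc zero}    _ (s≤s ()) _
encode-descending< {suc (suc r)} {c} π _ c≤p = begin-strict
  c * 4 + lowBits π descending  ≤⟨ +-mono-≤ (*-monoˡ-≤ 4 c≤p) (lowBits≤3 π descending) ⟩
  suc (suc r) * 4 + 3           <⟨ ≤-trans (n<1+n _) (m≤m+n _ r) ⟩
  suc (suc (suc r) * 4 + 3) + r ≡⟨ identity r ⟩
  5 * suc (suc r) + 2           ∎
  where
  open ≤-Reasoning
  identity : ∀ r → suc (suc (suc r) * 4 + 3) + r ≡ 5 * suc (suc r) + 2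
  identity = solve-∀

encode-descending-0< : ∀ {p} π → 1 ≤ p → encode ⟨ π , descending , 0 ⟩ < 5 * p + 2
encode-descending-0< {suc r} π _ = begin-strict
  lowBits π descending  ≤⟨ lowBits≤3 π descending ⟩
  3                     <⟨ ≤-trans (n<1+n 3) (m≤m+n 4 (3 + 5 * r)) ⟩
  4 + (3 + 5 * r)       ≡⟨ identity r ⟩
  5 * suc r + 2         ∎
  where
  open ≤-Reasoning
  identity : ∀ r → 4 + (3 + 5 * r) ≡ 5 * suc r + 2
  identity = solve-∀

stackLayout-fromLabels : ∀ (H : Graph) (S : ℕ) (σ : Permutation′ (n H))
  (label : ∀ {u v} → E H u v → ℕ) →
  (∀ {u v} (e : E H u v) → label (Graph.sym H e) ≡ label e) →
  (∀ {u v} (e : E H u v) → label e < S) →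
  (∀ {u v x y} (e : E H u v) (f : E H x y) → Crossing σ u v x y → label e ≢ label f) →
  StackLayout H S
stackLayout-fromLabels H S σ label label-sym label<S separated = record
  { σ         = σ
  ; stack     = λ e → fromℕ< (label<S e)
  ; stack-sym = λ e → fromℕ<-cong _ _ (label-sym e) _ _
  ; noCross   = λ e f crossing eq → separated e f crossing (fromℕ<-injective _ _ _ _ eq)
  }

module SnakeLayout (G : Graph) (p : ℕ) (D : PathDecomposition G) (width : WidthAtMost D p) (k : ℕ) where

  open GreedyColouring G p D width

  V : Set
  V = Fin (k * n G)

  block : V → ℕ
  block P = toℕ (proj₁ (remQuot {k} (n G) P))

  vertex : V → Fin (n G)
  vertex P = proj₂ (remQuot {k} (n G) P)

  remQuot-injective : ∀ {P Q : V} → remQuot {k} (n G) P ≡ remQuot {k} (n G) Q → P ≡ Q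
  remQuot-injective {P} {Q} e =
    ≡.trans (≡.sym (combine-remQuot {k} (n G) P))
      (≡.trans (cong (uncurry combine) e) (combine-remQuot {k} (n G) Q))

  T : ℕ
  T = len D * n G

  localKey : Parity → Fin (n G) → ℕ
  localKey 0ℙ v = key v
  localKey 1ℙ v = T ∸ suc (key v)   -- no truncation, as key v < T

  localKey< : ∀ π v → localKey π v < T
  localKey< 0ℙ v = key< v
  localKey< 1ℙ v = ∸-monoʳ-< {T} {suc (key v)} {0} (s≤s z≤n) (key< v)

  localKey-injective : ∀ π → Injective _≡_ _≡_ (localKey π)
  localKey-injective 0ℙ e = key-injective e
  localKey-injective 1ℙ {u} {v} e = key-injective (suc-injective (∸-cancelˡ-≡ (key< u) (key< v) e))

  localKey-<⇒Before : ∀ π {u v} → localKey π u < localKey π v → Before π u v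
  localKey-<⇒Before 0ℙ lt = lt
  localKey-<⇒Before 1ℙ {u} {v} lt = m<1+n⇒m≤n (∸-cancelʳ-< {suc (key u)} {suc (key v)} {T} lt)

  snakeKey : V → ℕ
  snakeKey P = block P * T + localKey (parity (block P)) (vertex P)

  snakeKey-injective : Injective _≡_ _≡_ snakeKey
  snakeKey-injective {P} {Q} e
    with lex-injective {a = block P} {b = block Q}
           (localKey< (parity (block P)) (vertex P)) (localKey< (parity (block Q)) (vertex Q)) e
  ... | blocks≡ , locals≡ = remQuot-injective (cong₂ _,_ (toℕ-injective blocks≡) vertices≡)
    where
    vertices≡ : vertex P ≡ vertex Q
    vertices≡ = localKey-injective (parity (block P))
                  (≡.trans locals≡ (cong (λ b → localKey (parity b) (vertex Q)) (≡.sym blocks≡)))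

  snakeKey-<⇒block-≤ : ∀ {P Q} → snakeKey P < snakeKey Q → block P ≤ block Q
  snakeKey-<⇒block-≤ {Q = Q} lt = lex-≤⇒≤ (localKey< (parity (block Q)) (vertex Q)) (<⇒≤ lt)

  snakeKey-<⇒Before : ∀ {P Q} i → block P ≡ i → block Q ≡ i → snakeKey P < snakeKey Q →
                      Before (parity i) (vertex P) (vertex Q)
  snakeKey-<⇒Before {P} {Q} i refl Q-in-i lt =
    localKey-<⇒Before (parity i)
      (+-cancelˡ-< (i * T) _ _ (subst (λ b → i * T + _ < b * T + localKey (parity b) (vertex Q)) Q-in-i lt))

  open Ranking snakeKey snakeKey-injective using (σ; σ-reflects-<)

  Pₖ⊠G : Graph
  Pₖ⊠G = Path k ⊠ G

  descendingColour : Dec (2 ≤ p) → Fin (n G) → ℕ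
  descendingColour (yes _) v = toℕ (colour v)
  descendingColour (no _)  _ = 0

  withinLabel : ℕ → Fin (n G) → Fin (n G) → StackLabel
  withinLabel i x y = ⟨ parity i , ascending , toℕ (lowerColour x y) ⟩

  gapLabel : ℕ → Fin (n G) → Fin (n G) → StackLabel
  gapLabel i x y with key x ≤? key y
  ... | yes _ = ⟨ parity i , ascending , toℕ (colour x) ⟩
  ... | no _  = ⟨ parity i , descending , descendingColour (2 ≤? p) y ⟩

  stepLabel : ∀ P Q → suc (block P) ≡ block Q ⊎ suc (block Q) ≡ block P → StackLabel
  stepLabel P Q (inj₁ _) = gapLabel (block P) (vertex P) (vertex Q)
  stepLabel P Q (inj₂ _) = gapLabel (block Q) (vertex Q) (vertex P)

  edgeLabel : ∀ {P Q} → E Pₖ⊠G P Q → StackLabel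
  edgeLabel {P} {Q} (inj₁ _)                 = withinLabel (block P) (vertex P) (vertex Q)
  edgeLabel {P} {Q} (inj₂ (inj₁ (_ , step))) = stepLabel P Q step
  edgeLabel {P} {Q} (inj₂ (inj₂ (step , _))) = stepLabel P Q step

  edgeLabel-sym : ∀ {P Q} (e : E Pₖ⊠G P Q) → edgeLabel (Graph.sym Pₖ⊠G e) ≡ edgeLabel e
  edgeLabel-sym {P} {Q} (inj₁ (same , _)) =
    cong₂ (λ i c → ⟨ parity i , ascending , toℕ c ⟩)
      (cong toℕ (≡.sym same)) (lowerColour-sym (vertex Q) (vertex P))
  edgeLabel-sym (inj₂ (inj₁ (_ , inj₁ _))) = refl
  edgeLabel-sym (inj₂ (inj₁ (_ , inj₂ _))) = refl
  edgeLabel-sym (inj₂ (inj₂ (inj₁ _ , _))) = refl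
  edgeLabel-sym (inj₂ (inj₂ (inj₂ _ , _))) = refl

  data Shape (P Q : V) (ℓ : StackLabel) : Set where
    within  : block Q ≡ block P → E G (vertex P) (vertex Q) →
              ℓ ≡ withinLabel (block P) (vertex P) (vertex Q) → Shape P Q ℓ
    rising  : block Q ≡ suc (block P) → vertex P ⋆ vertex Q → key (vertex P) ≤ key (vertex Q) →
              ℓ ≡ ⟨ parity (block P) , ascending , toℕ (colour (vertex P)) ⟩ → Shape P Q ℓ
    falling : block Q ≡ suc (block P) → vertex P ⋆ vertex Q → key (vertex Q) < key (vertex P) →
              ℓ ≡ ⟨ parity (block P) , descending , descendingColour (2 ≤? p) (vertex Q) ⟩ → Shape P Q ℓ

  gapShape : ∀ {P Q} → block Q ≡ suc (block P) → vertex P ⋆ vertex Q →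
             Shape P Q (gapLabel (block P) (vertex P) (vertex Q))
  gapShape {P} {Q} next adjacent with key (vertex P) ≤? key (vertex Q)
  ... | yes P≤Q = rising next adjacent P≤Q refl
  ... | no P≰Q  = falling next adjacent (≰⇒> P≰Q) refl

  stepShape : ∀ {P Q} (step : suc (block P) ≡ block Q ⊎ suc (block Q) ≡ block P) →
              vertex P ⋆ vertex Q → block P ≤ block Q → Shape P Q (stepLabel P Q step)
  stepShape (inj₁ next) adjacent _   = gapShape (≡.sym next) adjacent
  stepShape (inj₂ prev) _        P≤Q = contradiction (≤-trans (≤-reflexive prev) P≤Q) (<-irrefl refl)

  shape : ∀ {P Q} (e : E Pₖ⊠G P Q) → block P ≤ block Q → Shape P Q (edgeLabel e)
  shape (inj₁ (same , g))                 _   = within (cong toℕ (≡.sym same)) g refl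
  shape {P} (inj₂ (inj₁ (same , step))) P≤Q = stepShape step (subst (vertex P ⋆_) same refl) P≤Q
  shape (inj₂ (inj₂ (step , g)))          P≤Q = stepShape step [ g ] P≤Q

  toℕ-colour≤p : ∀ (c : Fin (suc p)) → toℕ c ≤ p
  toℕ-colour≤p c = m<1+n⇒m≤n (toℕ<n c)

  descending-bounded : ∀ π {u v} (w : Dec (2 ≤ p)) → u ⋆ v → key v < key u →
                       encode ⟨ π , descending , descendingColour w v ⟩ < 5 * p + 2
  descending-bounded π {v = v} (yes 2≤p) _ _ = encode-descending< π 2≤p (toℕ-colour≤p (colour v))
  descending-bounded π (no _) u⋆v v<u = encode-descending-0< π (falling⇒1≤p u⋆v v<u)

  shape-bounded : ∀ {P Q ℓ} → Shape P Q ℓ → encode ℓ < 5 * p + 2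
  shape-bounded {P} {Q} (within _ _ refl) =
    encode-ascending< (parity (block P)) (toℕ-colour≤p (lowerColour (vertex P) (vertex Q)))
  shape-bounded {P} (rising _ _ _ refl) =
    encode-ascending< (parity (block P)) (toℕ-colour≤p (colour (vertex P)))
  shape-bounded {P} (falling _ adj lt refl) =
    descending-bounded (parity (block P)) (2 ≤? p) adj lt

  edge-bounded : ∀ {P Q} (e : E Pₖ⊠G P Q) → encode (edgeLabel e) < 5 * p + 2
  edge-bounded {P} {Q} e with block P ≤? block Q
  ... | yes P≤Q = shape-bounded (shape e P≤Q)
  ... | no P≰Q  = subst (λ ℓ → encode ℓ < 5 * p + 2) (edgeLabel-sym e)
                    (shape-bounded (shape (Graph.sym Pₖ⊠G e) (<⇒≤ (≰⇒> P≰Q))))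

  slopes-differ : ∀ {ℓ π π′ c c′} → ℓ ≡ ⟨ π , ascending , c ⟩ → ℓ ≡ ⟨ π′ , descending , c′ ⟩ → ⊥
  slopes-differ e e′ with () ← proj₁ (proj₂ (labels-agree e e′))

  falling-pair : ∀ π {u v x y} (w : Dec (2 ≤ p)) → u ⋆ v → x ⋆ y → key v < key u → key y < key x →
                 Before π u x → Before (π ⁻¹) v y → descendingColour w v ≢ descendingColour w y
  falling-pair π (yes _) u⋆v x⋆y v<u y<x u≺x v≺y eq =
    falling-crossing π u⋆v x⋆y v<u y<x u≺x v≺y (toℕ-injective eq)
  falling-pair π (no 2≰p) u⋆v x⋆y v<u y<x u≺x v≺y _ =
    falling-crossing-narrow (m<1+n⇒m≤n (≰⇒> 2≰p)) π u⋆v x⋆y v<u y<x u≺x v≺y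

  module Interleaved {P₁ P₂ P₃ P₄ : V} (k₁₃ : snakeKey P₁ < snakeKey P₃)
                     (k₃₂ : snakeKey P₃ < snakeKey P₂) (k₂₄ : snakeKey P₂ < snakeKey P₄) where

    b₁ : ℕ
    b₁ = block P₁

    b₁≤b₃ : b₁ ≤ block P₃
    b₁≤b₃ = snakeKey-<⇒block-≤ k₁₃

    b₃≤b₂ : block P₃ ≤ block P₂
    b₃≤b₂ = snakeKey-<⇒block-≤ k₃₂

    b₂≤b₄ : block P₂ ≤ block P₄
    b₂≤b₄ = snakeKey-<⇒block-≤ k₂₄

    same-block₃ : block P₂ ≡ b₁ → block P₃ ≡ b₁
    same-block₃ h₂ = ≤-antisym (≤-trans b₃≤b₂ (≤-reflexive h₂)) b₁≤b₃

    next-block₃ : block P₂ ≡ suc b₁ → parity b₁ ≡ parity (block P₃) → block P₃ ≡ b₁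
    next-block₃ h₂ same-parity = same-parity⇒≡ b₁≤b₃ (≤-trans b₃≤b₂ (≤-reflexive h₂)) same-parity

    lower : block P₃ ≡ b₁ → Before (parity b₁) (vertex P₁) (vertex P₃)
    lower h₃ = snakeKey-<⇒Before b₁ refl h₃ k₁₃

    upper : block P₂ ≡ suc b₁ → block P₄ ≡ suc b₁ → Before (parity b₁ ⁻¹) (vertex P₂) (vertex P₄)
    upper h₂ h₄ =
      subst (λ π → Before π (vertex P₂) (vertex P₄)) (parity-suc b₁) (snakeKey-<⇒Before (suc b₁) h₂ h₄ k₂₄)

    shapes-do-not-cross : ∀ {ℓ} → Shape P₁ P₂ ℓ → Shape P₃ P₄ ℓ → ⊥
    shapes-do-not-cross (within h₂ g₁ e₁) (within h₄ g₃ e₃) =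
      within-crossing (parity b₁) g₁ g₃ (lower b₃) (snakeKey-<⇒Before b₁ b₃ h₂ k₃₂)
        (snakeKey-<⇒Before b₁ h₂ (≡.trans h₄ b₃) k₂₄) (toℕ-injective (proj₂ (proj₂ (labels-agree e₁ e₃))))
      where b₃ = same-block₃ h₂
    shapes-do-not-cross (within h₂ g₁ e₁) (rising _ _ _ e₃) =
      lowerColour-between (parity b₁) g₁ (lower b₃) (snakeKey-<⇒Before b₁ b₃ h₂ k₃₂)
        (toℕ-injective (proj₂ (proj₂ (labels-agree e₁ e₃))))
      where b₃ = same-block₃ h₂
    shapes-do-not-cross (rising h₂ _ _ e₁) (within h₄ _ e₃) =
      <-irrefl refl (subst₂ _≤_ h₂ (≡.trans h₄ (next-block₃ h₂ (proj₁ (labels-agree e₁ e₃)))) b₂≤b₄)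
    shapes-do-not-cross (rising h₂ a₁ l₁ e₁) (rising h₄ a₃ l₃ e₃) with labels-agree e₁ e₃
    ... | same-parity , _ , same-colour =
      rising-crossing (parity b₁) a₁ a₃ l₁ l₃ (lower b₃) (upper h₂ (≡.trans h₄ (cong suc b₃)))
        (toℕ-injective same-colour)
      where b₃ = next-block₃ h₂ same-parity
    shapes-do-not-cross (falling h₂ a₁ l₁ e₁) (falling h₄ a₃ l₃ e₃) with labels-agree e₁ e₃
    ... | same-parity , _ , same-colour =
      falling-pair (parity b₁) (2 ≤? p) a₁ a₃ l₁ l₃ (lower b₃) (upper h₂ (≡.trans h₄ (cong suc b₃))) same-colour
      where b₃ = next-block₃ h₂ same-parity
    shapes-do-not-cross (within _ _ e₁)    (falling _ _ _ e₃) = slopes-differ e₁ e₃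
    shapes-do-not-cross (rising _ _ _ e₁)  (falling _ _ _ e₃) = slopes-differ e₁ e₃
    shapes-do-not-cross (falling _ _ _ e₁) (within _ _ e₃)    = slopes-differ e₃ e₁
    shapes-do-not-cross (falling _ _ _ e₁) (rising _ _ _ e₃)  = slopes-differ e₃ e₁

  crossing-edges-differ : ∀ {P₁ P₂ P₃ P₄} (e : E Pₖ⊠G P₁ P₂) (f : E Pₖ⊠G P₃ P₄) → Crossing σ P₁ P₂ P₃ P₄ →
                          encode (edgeLabel e) ≢ encode (edgeLabel f)
  crossing-edges-differ {P₃ = P₃} {P₄} e f (σ₁₃ , σ₃₂ , σ₂₄) eq =
    shapes-do-not-cross (shape e (≤-trans b₁≤b₃ b₃≤b₂))
      (subst (Shape P₃ P₄) (≡.sym (encode-injective eq)) (shape f (≤-trans b₃≤b₂ b₂≤b₄)))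
    where open Interleaved (σ-reflects-< σ₁₃) (σ-reflects-< σ₃₂) (σ-reflects-< σ₂₄)

  snake-layout : StackLayout Pₖ⊠G (5 * p + 2)
  snake-layout = stackLayout-fromLabels Pₖ⊠G (5 * p + 2) σ (encode ∘ edgeLabel) (cong encode ∘ edgeLabel-sym)
                   edge-bounded crossing-edges-differ

corollary1 : (G : Graph) (p : ℕ) → Pathwidth G p →
    (k : ℕ) → sn≤ (Path k ⊠ G) (5 * p + 2)
corollary1 G p ((D , width) , _) k = SnakeLayout.snake-layout G p D width k
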